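{- Suppose $\Phi\subseteq\{I,O,U\}$ and let $\mathcal{I}$ be an interpretation. Then: (1) for every $\varphi$ which is either a terminological axiom in $\mathcal{L}_\Phi$ or a concept assertion $C(a)$ in $\mathcal{L}_\Phi$, $\mathcal{I}\models\varphi$ iff $\mathcal{I}/_{\sim_{\Phi,\mathcal{I}}}\models\varphi$; (2) for every $\varphi$ which is either a role inclusion axiom or an individual assertion of the form $R(a,b)$ or $a=b$, if $\mathcal{I}\models\varphi$ then $\mathcal{I}/_{\sim_{\Phi,\mathcal{I}}}\models\varphi$.
   Context: Fix finite sets $\Sigma_C,\Sigma_R,\Sigma_I$ of concept, role and individual names. Roles/concepts of $\mathcal{L}_\Phi$ ($\Phi\subseteq\{I,O,U\}$): $r\in\Sigma_R$ roles, $A\in\Sigma_C$ concepts; closed under role constructors $\varepsilon, R\circ S, R\sqcup S, R^*, C?$ and concept constructors $\top,\bot,\neg C,C\sqcap D,C\sqcup D,\forall R.C,\exists R.C$; plus $R^-$ if $I\in\Phi$; $\{a\}$ if $O\in\Phi$; role $U$ if $U\in\Phi$. Standard semantics (composition, union, reflexive-transitive closure, $(C?)^{\mathcal{I}}=\{(x,x):x\in C^{\mathcal{I}}\}$, $\varepsilon^{\mathcal{I}}$ identity, $U^{\mathcal{I}}=(\Delta^{\mathcal{I}})^2$, inverse, Booleans, $\{a\}^{\mathcal{I}}=\{a^{\mathcal{I}}\}$, $\forall,\exists$ as usual). Terminological axiom: $C\sqsubseteq D$, valid iff $C^{\mathcal{I}}\subseteq D^{\mathcal{I}}$. Basic roles: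 $\Sigma_R\cup\{r^-:r\in\Sigma_R\}$ if $I\in\Phi$, else $\Sigma_R$. Role inclusion axiom: $\varepsilon\sqsubseteq r$ or $R_1\circ\dots\circ R_k\sqsubseteq r$ ($k\ge1$, $R_i$ basic), valid iff $\varepsilon^{\mathcal{I}}\subseteq r^{\mathcal{I}}$ resp. $R_1^{\mathcal{I}}\circ\dots\circ R_k^{\mathcal{I}}\subseteq r^{\mathcal{I}}$. Assertions: $\mathcal{I}\models C(a)$ iff $a^{\mathcal{I}}\in C^{\mathcal{I}}$; $\mathcal{I}\models R(a,b)$ iff $(a^{\mathcal{I}},b^{\mathcal{I}})\in R^{\mathcal{I}}$; $\mathcal{I}\models a=b$ iff $a^{\mathcal{I}}=b^{\mathcal{I}}$. $Z\subseteq\Delta^{\mathcal{I}}\times\Delta^{\mathcal{I}'}$ is an $\mathcal{L}_\Phi$-bisimulation if for all $a,A,r$, $x,y\in\Delta^{\mathcal{I}}$, $x',y'\in\Delta^{\mathcal{I}'}$: (B1) $Z(a^{\mathcal{I}},a^{\mathcal{I}'})$; (B2) $Z(x,x')\Rightarrow(x\in A^{\mathcal{I}}\iff x'\in A^{\mathcal{I}'})$; (B3) $Z(x,x')\wedge(x,y)\in r^{\mathcal{I}}\Rightarrow\exists y'(Z(y,y')\wedge(x',y')\in r^{\mathcal{I}'})$; (B4) $Z(x,x')\wedge(x',y')\in r^{\mathcal{I}'}\Rightarrow\exists y(Z(y,y')\wedge(x,y)\in r^{\mathcal{I}})$; if $I\in\Phi$: (B5),(B6) analogous for predecessors; if $O\in\Phi$: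 (B7) $Z(x,x')\Rightarrow(x=a^{\mathcal{I}}\iff x'=a^{\mathcal{I}'})$; if $U\in\Phi$: (B10),(B11) $Z$ total on $\Delta^{\mathcal{I}}$ and surjective onto $\Delta^{\mathcal{I}'}$. $\sim_{\Phi,\mathcal{I}}$ is the largest $\mathcal{L}_\Phi$-bisimulation between $\mathcal{I}$ and itself (an equivalence relation). The quotient $\mathcal{I}/_{\sim_{\Phi,\mathcal{I}}}$ has domain the set of equivalence classes $[x]$, $a\mapsto[a^{\mathcal{I}}]$, $A\mapsto\{[x]:x\in A^{\mathcal{I}}\}$, $r\mapsto\{([x],[y]):(x,y)\in r^{\mathcal{I}}\}$. -}

module Defs where

open import Level using (Level) renaming (zero to 0ℓ; suc to lsuc)
open import Data.Nat using (ℕ)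
open import Data.Fin using (Fin)
open import Data.Bool using (Bool; T)
open import Data.Product using (Σ; Σ-syntax; _×_; _,_)
open import Data.Sum using (_⊎_)
open import Data.List.NonEmpty using (List⁺; _∷_)
open import Data.List using (List; []; _∷_)
open import Data.Unit.Polymorphic using (⊤)
open import Data.Empty.Polymorphic using (⊥)
open import Relation.Binary.PropositionalEquality using (_≡_)
open import Function.Bundles using (_⇔_)

record Sig : Set where
  field
    nC nR nI : ℕ

CN RN IN : Sig → Set
CN S = Fin (Sig.nC S)
RN S = Fin (Sig.nR S)
IN S = Fin (Sig.nI S)

record Phi : Set where
  field
    hasI hasO hasU : Bool

I∈ O∈ U∈ : Phi → Set
I∈ Φ = T (Phi.hasI Φ)
O∈ Φ = T (Phi.hasO Φ)
U∈ Φ = T (Phi.hasU Φ)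

mutual
  data Role (S : Sig) (Φ : Phi) : Set where
    rname : RN S → Role S Φ
    eps   : Role S Φ
    _∘ᵣ_  : Role S Φ → Role S Φ → Role S Φ
    _⊔ᵣ_  : Role S Φ → Role S Φ → Role S Φ
    _*    : Role S Φ → Role S Φ
    _??   : Concept S Φ → Role S Φ
    inv   : I∈ Φ → Role S Φ → Role S Φ
    univ  : U∈ Φ → Role S Φ

  data Concept (S : Sig) (Φ : Phi) : Set where
    cname : CN S → Concept S Φ
    top   : Concept S Φ
    bot   : Concept S Φ
    neg   : Concept S Φ → Concept S Φ
    _⊓c_  : Concept S Φ → Concept S Φ → Concept S Φ
    _⊔c_  : Concept S Φ → Concept S Φ → Concept S Φ
    all   : Role S Φ → Concept S Φ → Concept S Φ
    ex    : Role S Φ → Concept S Φ → Concept S Φ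
    nom   : O∈ Φ → IN S → Concept S Φ

data BasicRole (S : Sig) (Φ : Phi) : Set where
  bname : RN S → BasicRole S Φ
  binv  : I∈ Φ → RN S → BasicRole S Φ

data Form₁ (S : Sig) (Φ : Phi) : Set where
  _⊑_    : Concept S Φ → Concept S Φ → Form₁ S Φ
  _⟨_⟩   : Concept S Φ → IN S → Form₁ S Φ

data Form₂ (S : Sig) (Φ : Phi) : Set where
  riaε    : RN S → Form₂ S Φ
  ria     : List⁺ (BasicRole S Φ) → RN S → Form₂ S Φ
  rasrt   : Role S Φ → IN S → IN S → Form₂ S Φ
  eqasrt  : IN S → IN S → Form₂ S Φ

record Interp (S : Sig) : Set₁ where
  field
    Δ    : Set
    conc : CN S → Δ → Set
    role : RN S → Δ → Δ → Set
    ind  : IN S → Δ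

-- A "setoid interpretation": domain given by representatives together with
-- an equality _≈_ on them (needed to represent quotient interpretations,
-- whose elements are equivalence classes).  Extensions are read on
-- representatives.

record SInterp (S : Sig) (ℓ : Level) : Set (lsuc ℓ) where
  field
    Δ    : Set
    _≈_  : Δ → Δ → Set ℓ
    conc : CN S → Δ → Set ℓ
    role : RN S → Δ → Δ → Set ℓ
    ind  : IN S → Δ

toS : ∀ {S} → Interp S → SInterp S 0ℓ
toS 𝓘 = record
  { Δ = Δ ; _≈_ = _≡_ ; conc = conc ; role = role ; ind = ind }
  where open Interp 𝓘

-- reflexive–transitive closure of R, the reflexive part being the
-- identity (equality) of the domain
data Star {ℓ} {D : Set} (E : D → D → Set ℓ) (R : D → D → Set ℓ)
          : D → D → Set ℓ where
  base : ∀ {x y} → E x y → Star E R x y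
  step : ∀ {x y z} → R x y → Star E R y z → Star E R x z

module _ {S : Sig} {Φ : Phi} {ℓ : Level} (𝓘 : SInterp S ℓ) where
  open SInterp 𝓘

  mutual
    ⟦_⟧R : Role S Φ → Δ → Δ → Set ℓ
    ⟦ rname r ⟧R x y = role r x y
    ⟦ eps ⟧R x y = x ≈ y
    ⟦ R ∘ᵣ R' ⟧R x y = Σ[ z ∈ Δ ] (⟦ R ⟧R x z × ⟦ R' ⟧R z y)
    ⟦ R ⊔ᵣ R' ⟧R x y = ⟦ R ⟧R x y ⊎ ⟦ R' ⟧R x y
    ⟦ R * ⟧R x y = Star _≈_ ⟦ R ⟧R x y
    ⟦ C ?? ⟧R x y = x ≈ y × ⟦ C ⟧C x
    ⟦ inv _ R ⟧R x y = ⟦ R ⟧R y x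
    ⟦ univ _ ⟧R x y = ⊤

    ⟦_⟧C : Concept S Φ → Δ → Set ℓ
    ⟦ cname A ⟧C x = conc A x
    ⟦ top ⟧C x = ⊤
    ⟦ bot ⟧C x = ⊥
    ⟦ neg C ⟧C x = ⟦ C ⟧C x → ⊥ {ℓ}
    ⟦ C ⊓c D ⟧C x = ⟦ C ⟧C x × ⟦ D ⟧C x
    ⟦ C ⊔c D ⟧C x = ⟦ C ⟧C x ⊎ ⟦ D ⟧C x
    ⟦ all R C ⟧C x = ∀ y → ⟦ R ⟧R x y → ⟦ C ⟧C y
    ⟦ ex R C ⟧C x = Σ[ y ∈ Δ ] (⟦ R ⟧R x y × ⟦ C ⟧C y)
    ⟦ nom _ a ⟧C x = x ≈ ind a

  ⟦_⟧B : BasicRole S Φ → Δ → Δ → Set ℓ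
  ⟦ bname r ⟧B x y = role r x y
  ⟦ binv _ r ⟧B x y = role r y x

  chain : BasicRole S Φ → List (BasicRole S Φ) → Δ → Δ → Set ℓ
  chain R [] x y = ⟦ R ⟧B x y
  chain R (R' ∷ Rs) x y = Σ[ z ∈ Δ ] (⟦ R ⟧B x z × chain R' Rs z y)

  _⊨₁_ : Form₁ S Φ → Set ℓ
  _⊨₁_ (C ⊑ D) = ∀ x → ⟦ C ⟧C x → ⟦ D ⟧C x
  _⊨₁_ (C ⟨ a ⟩) = ⟦ C ⟧C (ind a)

  _⊨₂_ : Form₂ S Φ → Set ℓ
  _⊨₂_ (riaε r) = ∀ x y → x ≈ y → role r x y
  _⊨₂_ (ria (R ∷ Rs) r) = ∀ x y → chain R Rs x y → role r x y
  _⊨₂_ (rasrt R a b) = ⟦ R ⟧R (ind a) (ind b)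
  _⊨₂_ (eqasrt a b) = ind a ≈ ind b

record IsBisim {S : Sig} (Φ : Phi) (𝓘 : Interp S)
               (Z : Interp.Δ 𝓘 → Interp.Δ 𝓘 → Set) : Set where
  open Interp 𝓘
  field
    B1  : ∀ a → Z (ind a) (ind a)
    B2  : ∀ A {x x'} → Z x x' → (conc A x ⇔ conc A x')
    B3  : ∀ r {x x' y} → Z x x' → role r x y →
            Σ[ y' ∈ Δ ] (Z y y' × role r x' y')
    B4  : ∀ r {x x' y'} → Z x x' → role r x' y' →
            Σ[ y ∈ Δ ] (Z y y' × role r x y)
    B5  : I∈ Φ → ∀ r {x x' y} → Z x x' → role r y x →
            Σ[ y' ∈ Δ ] (Z y y' × role r y' x')
    B6  : I∈ Φ → ∀ r {x x' y'} → Z x x' → role r y' x' →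
            Σ[ y ∈ Δ ] (Z y y' × role r y x)
    B7  : O∈ Φ → ∀ a {x x'} → Z x x' → (x ≡ ind a ⇔ x' ≡ ind a)
    B10 : U∈ Φ → ∀ x → Σ[ x' ∈ Δ ] Z x x'
    B11 : U∈ Φ → ∀ x' → Σ[ x ∈ Δ ] Z x x'

-- ∼_{Φ,𝓘}: the largest L_Φ-bisimulation, i.e. the union of all of them
Bisimilar : ∀ {S} (Φ : Phi) (𝓘 : Interp S) →
            Interp.Δ 𝓘 → Interp.Δ 𝓘 → Set₁
Bisimilar Φ 𝓘 x y =
  Σ[ Z ∈ (Interp.Δ 𝓘 → Interp.Δ 𝓘 → Set) ] (IsBisim Φ 𝓘 Z × Z x y)

-- the quotient interpretation 𝓘/∼_{Φ,𝓘}: elements are classes [x],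
-- represented by x, with [x] = [y] iff x ∼ y
Quotient : ∀ {S} (Φ : Phi) (𝓘 : Interp S) → SInterp S (lsuc 0ℓ)
Quotient Φ 𝓘 = record
  { Δ    = Δ
  ; _≈_  = _∼_
  ; conc = λ A z → Σ[ x ∈ Δ ] (x ∼ z × conc A x)
  ; role = λ r z w → Σ[ x ∈ Δ ] Σ[ y ∈ Δ ] (x ∼ z × y ∼ w × role r x y)
  ; ind  = ind
  }
  where
    open Interp 𝓘
    _∼_ = Bisimilar Φ 𝓘

-- Forth-simulations are closed under the relational operations that
--     interpret role constructors (identity, test, union, composition,
--     reflexive-transitive closure, the full relation), and so are their
--     backward (predecessor) versions.
--   * Bisimulation invariance.  L_Φ-bisimulations contain the identity and
--     are closed under converse and composition, so ∼ is an equivalence; by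
--     induction on syntax every concept is preserved along any bisimulation
--     and every role is forth- (and, with I ∈ Φ, back-) simulated by it.
--   * The quotient.  By mutual induction, concepts have the same extension in
--     𝓘 and in 𝓘/∼, every role of 𝓘 is contained in its quotient
--     interpretation, and conversely a quotient role step is a role step of 𝓘
--     up to ∼ at the target (generic "up to" lemmas handle composition and
--     closure).  Part (1) of the theorem is concept invariance;
--     part (2) follows by applying the two role inclusions to role assertions
--     and to the role chains R₁ ∘ … ∘ Rₖ of role inclusion axioms.
module Submission where

open import Defs
open import Data.Product using (_×_)
open import Function.Bundles using (_⇔_)

open import Level using (Level; _⊔_) renaming (zero to 0ℓ)
open import Data.Product using (∃; _,_; map₁; map₂)
open import Data.Sum using (inj₁; inj₂)
open import Data.List using (List; []; _∷_)
open import Data.List.NonEmpty using (_∷_)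
open import Data.Unit.Polymorphic using (⊤; tt)
open import Data.Empty.Polymorphic using (⊥-elim)
open import Function.Base using (flip)
open import Function.Bundles using (mk⇔; Equivalence)
open import Function.Properties.Equivalence using (⇔-isEquivalence)
open import Relation.Binary.Core using (Rel; REL; _⇒_)
open import Relation.Binary.Structures using (IsEquivalence)
open import Relation.Binary.PropositionalEquality using (_≡_; refl)
open import Relation.Binary.Construct.Composition using (_;_)
open import Relation.Binary.Construct.Union using (_∪_)

private
  variable
    z t t' p p' e : Level
    A B : Set

Forth : REL A B z → Rel A t → Rel B t' → Set (z ⊔ t ⊔ t')
Forth Z T T' = ∀ {x x' y} → Z x x' → T x y → ∃ λ y' → Z y y' × T' x' y'

Back : REL A B z → Rel A t → Rel B t' → Set (z ⊔ t ⊔ t')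
Back Z T T' = Forth Z (flip T) (flip T')

Test : (A → Set p) → Rel A p
Test P x y = x ≡ y × P x

Full : Rel A t
Full _ _ = ⊤

module _ {Z : REL A B z} where

  forth-≡ : Forth Z _≡_ _≡_
  forth-≡ {x' = x'} zx refl = x' , zx , refl

  back-≡ : Back Z _≡_ _≡_
  back-≡ {x' = x'} zx refl = x' , zx , refl

  forth-test : {P : A → Set p} {P' : B → Set p'} →
               (∀ {x x'} → Z x x' → P x → P' x') → Forth Z (Test P) (Test P')
  forth-test pres {x' = x'} zx (refl , px) = x' , zx , refl , pres zx px

  back-test : {P : A → Set p} {P' : B → Set p'} →
              (∀ {x x'} → Z x x' → P x → P' x') → Back Z (Test P) (Test P')
  back-test pres {x' = x'} zx (refl , px) = x' , zx , refl , pres zx px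

  forth-full : (∀ y → ∃ λ y' → Z y y') → Forth Z (Full {t = t}) (Full {t = t'})
  forth-full total {y = y} zx _ = let (y' , zy) = total y in y' , zy , tt

  -- (this also serves backwards, as flip commutes with ∪)
  forth-∪ : {T₁ T₂ : Rel A t} {T₁' T₂' : Rel B t'} →
            Forth Z T₁ T₁' → Forth Z T₂ T₂' → Forth Z (T₁ ∪ T₂) (T₁' ∪ T₂')
  forth-∪ sim₁ sim₂ zx (inj₁ h) = map₂ (map₂ inj₁) (sim₁ zx h)
  forth-∪ sim₁ sim₂ zx (inj₂ h) = map₂ (map₂ inj₂) (sim₂ zx h)

  forth-∘ : {T₁ T₂ : Rel A t} {T₁' T₂' : Rel B t'} →
            Forth Z T₁ T₁' → Forth Z T₂ T₂' → Forth Z (T₁ ; T₂) (T₁' ; T₂')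
  forth-∘ sim₁ sim₂ zx (w , h₁ , h₂) =
    let (w' , zw , h₁') = sim₁ zx h₁
        (y' , zy , h₂') = sim₂ zw h₂
    in y' , zy , w' , h₁' , h₂'

  back-∘ : {T₁ T₂ : Rel A t} {T₁' T₂' : Rel B t'} →
           Back Z T₁ T₁' → Back Z T₂ T₂' → Back Z (T₁ ; T₂) (T₁' ; T₂')
  back-∘ sim₁ sim₂ zx (w , h₁ , h₂) =
    let (w' , zw , h₂') = sim₂ zx h₂
        (y' , zy , h₁') = sim₁ zw h₁
    in y' , zy , w' , h₁' , h₂'

  forth-star : {T : Rel A 0ℓ} {T' : Rel B 0ℓ} →
               Forth Z T T' → Forth Z (Star _≡_ T) (Star _≡_ T')
  forth-star sim {x' = x'} zx (base refl) = x' , zx , base refl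
  forth-star sim zx (step h s) =
    let (w' , zw , h') = sim zx h
        (y' , zy , s') = forth-star sim zw s
    in y' , zy , step h' s'

  back-star : {T : Rel A 0ℓ} {T' : Rel B 0ℓ} →
              Back Z T T' → Back Z (Star _≡_ T) (Star _≡_ T')
  back-star sim {x' = x'} zx (base refl) = x' , zx , base refl
  back-star sim zx (step h s) =
    let (w' , zw , s') = back-star sim zx s
        (y' , zy , h') = sim zw h
    in y' , zy , step h' s'

star-mono : {E T : Rel A t} {E' T' : Rel A t'} → E ⇒ E' → T ⇒ T' → Star E T ⇒ Star E' T'
star-mono e⇒ t⇒ (base eq) = base (e⇒ eq)
star-mono e⇒ t⇒ (step h s) = step (t⇒ h) (star-mono e⇒ t⇒ s)

module UpTo {E : Rel A e} (E-equiv : IsEquivalence E) where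
  open IsEquivalence E-equiv using () renaming (sym to E-sym; trans to E-trans)

  ∘-up-to : {T₁ T₂ : Rel A e} {T₁' T₂' : Rel A 0ℓ} →
            T₁ ⇒ (T₁' ; E) → T₂ ⇒ (T₂' ; E) → Forth E T₂' T₂' →
            (T₁ ; T₂) ⇒ ((T₁' ; T₂') ; E)
  ∘-up-to inc₁ inc₂ sim₂ (w , h₁ , h₂) =
    let (w' , h₁' , w'Ew) = inc₁ h₁
        (y₁ , h₂' , y₁Ey) = inc₂ h₂
        (y₂ , y₁Ey₂ , h₂'') = sim₂ (E-sym w'Ew) h₂'
    in y₂ , (w' , h₁' , h₂'') , E-trans (E-sym y₁Ey₂) y₁Ey

  star-up-to : {T : Rel A e} {T' : Rel A 0ℓ} →
               T ⇒ (T' ; E) → Forth E T' T' → Star E T ⇒ (Star _≡_ T' ; E)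
  star-up-to inc sim {x} (base xEy) = x , base refl , xEy
  star-up-to inc sim (step h s) =
    let (w' , h' , w'Ew) = inc h
        (y₁ , s' , y₁Ey) = star-up-to inc sim s
        (y₂ , y₁Ey₂ , s'') = forth-star sim (E-sym w'Ew) s'
    in y₂ , step h' s'' , E-trans (E-sym y₁Ey₂) y₁Ey

module Bisimulations {S : Sig} {Φ : Phi} (𝓘 : Interp S) where
  open Interp 𝓘
  open IsBisim
  open IsEquivalence (⇔-isEquivalence {ℓ = 0ℓ}) using () renaming (sym to ⇔-sym; trans to ⇔-trans)

  ⟦_⟧ʳ : Role S Φ → Rel Δ 0ℓ
  ⟦_⟧ʳ = ⟦_⟧R (toS 𝓘)

  ⟦_⟧ᶜ : Concept S Φ → Δ → Set
  ⟦_⟧ᶜ = ⟦_⟧C (toS 𝓘)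

  identity-bisim : IsBisim Φ 𝓘 _≡_
  identity-bisim = record
    { B1 = λ _ → refl
    ; B2 = λ { A refl → mk⇔ (λ h → h) (λ h → h) }
    ; B3 = λ { _ refl h → _ , refl , h }
    ; B4 = λ { _ refl h → _ , refl , h }
    ; B5 = λ { _ _ refl h → _ , refl , h }
    ; B6 = λ { _ _ refl h → _ , refl , h }
    ; B7 = λ { _ a refl → mk⇔ (λ h → h) (λ h → h) }
    ; B10 = λ _ x → x , refl
    ; B11 = λ _ x → x , refl
    }

  converse-bisim : {Z : Rel Δ 0ℓ} → IsBisim Φ 𝓘 Z → IsBisim Φ 𝓘 (flip Z)
  converse-bisim b = record
    { B1 = B1 b
    ; B2 = λ A zx → ⇔-sym (B2 b A zx)
    ; B3 = λ r → B4 b r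
    ; B4 = λ r → B3 b r
    ; B5 = λ i r → B6 b i r
    ; B6 = λ i r → B5 b i r
    ; B7 = λ o a zx → ⇔-sym (B7 b o a zx)
    ; B10 = λ u x → B11 b u x
    ; B11 = λ u x → B10 b u x
    }

  compose-bisim : {Z Z' : Rel Δ 0ℓ} →
                  IsBisim Φ 𝓘 Z → IsBisim Φ 𝓘 Z' → IsBisim Φ 𝓘 (Z ; Z')
  compose-bisim b b' = record
    { B1 = λ a → ind a , B1 b a , B1 b' a
    ; B2 = λ { A (_ , zx , z'x) → ⇔-trans (B2 b A zx) (B2 b' A z'x) }
    ; B3 = λ r → compose-forth (B3 b r) (B3 b' r)
    ; B4 = λ r → compose-back (B4 b r) (B4 b' r)
    ; B5 = λ i r → compose-forth (B5 b i r) (B5 b' i r)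
    ; B6 = λ i r → compose-back (B6 b i r) (B6 b' i r)
    ; B7 = λ { o a (_ , zx , z'x) → ⇔-trans (B7 b o a zx) (B7 b' o a z'x) }
    ; B10 = λ u x → let (y , zy) = B10 b u x ; (w , z'w) = B10 b' u y in w , y , zy , z'w
    ; B11 = λ u x → let (y , z'y) = B11 b' u x ; (w , zw) = B11 b u y in w , y , zw , z'y
    }
    where
    compose-forth : {Z Z' : Rel Δ 0ℓ} {T : Rel Δ 0ℓ} →
                    Forth Z T T → Forth Z' T T → Forth (Z ; Z') T T
    compose-forth sim sim' (_ , zx , z'x) h =
      let (m , zy , h₁) = sim zx h ; (y' , z'y , h₂) = sim' z'x h₁
      in y' , (m , zy , z'y) , h₂

    compose-back : {Z Z' : Rel Δ 0ℓ} {T : Rel Δ 0ℓ} →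
                   Forth (flip Z) T T → Forth (flip Z') T T →
                   Forth (flip (Z ; Z')) T T
    compose-back sim sim' (_ , zx , z'x) h =
      let (m , z'y , h₁) = sim' z'x h ; (y , zy , h₂) = sim zx h₁
      in y , (m , zy , z'y) , h₂

  mutual
    concept-preserved : {Z : Rel Δ 0ℓ} → IsBisim Φ 𝓘 Z → (C : Concept S Φ) →
                        ∀ {x x'} → Z x x' → ⟦ C ⟧ᶜ x → ⟦ C ⟧ᶜ x'
    concept-preserved b (cname A) zx h = Equivalence.to (B2 b A zx) h
    concept-preserved b top zx h = tt
    concept-preserved b (neg C) zx h c = h (concept-preserved (converse-bisim b) C zx c)
    concept-preserved b (C ⊓c D) zx (c , d) =
      concept-preserved b C zx c , concept-preserved b D zx d
    concept-preserved b (C ⊔c D) zx (inj₁ c) = inj₁ (concept-preserved b C zx c)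
    concept-preserved b (C ⊔c D) zx (inj₂ d) = inj₂ (concept-preserved b D zx d)
    concept-preserved b (all R C) zx h y' r' =
      let (y , zy , r) = role-forth (converse-bisim b) R zx r'
      in concept-preserved b C zy (h y r)
    concept-preserved b (ex R C) zx (y , r , c) =
      let (y' , zy , r') = role-forth b R zx r
      in y' , r' , concept-preserved b C zy c
    concept-preserved b (nom o a) zx h = Equivalence.to (B7 b o a zx) h

    role-forth : {Z : Rel Δ 0ℓ} → IsBisim Φ 𝓘 Z → (R : Role S Φ) →
                 Forth Z ⟦ R ⟧ʳ ⟦ R ⟧ʳ
    role-forth b (rname r) = B3 b r
    role-forth b eps = forth-≡
    role-forth b (R ∘ᵣ R') = forth-∘ (role-forth b R) (role-forth b R')
    role-forth b (R ⊔ᵣ R') = forth-∪ {T₁ = ⟦ R ⟧ʳ} (role-forth b R) (role-forth b R')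
    role-forth b (R *) = forth-star (role-forth b R)
    role-forth b (C ??) = forth-test (concept-preserved b C)
    role-forth b (inv i R) = role-back b i R
    role-forth b (univ u) = forth-full (B10 b u)

    role-back : {Z : Rel Δ 0ℓ} → IsBisim Φ 𝓘 Z → I∈ Φ → (R : Role S Φ) →
                Back Z ⟦ R ⟧ʳ ⟦ R ⟧ʳ
    role-back b i (rname r) = B5 b i r
    role-back b i eps = back-≡
    role-back b i (R ∘ᵣ R') = back-∘ (role-back b i R) (role-back b i R')
    role-back b i (R ⊔ᵣ R') = forth-∪ {T₁ = flip ⟦ R ⟧ʳ} (role-back b i R) (role-back b i R')
    role-back b i (R *) = back-star (role-back b i R)
    role-back b i (C ??) = back-test (concept-preserved b C)
    role-back b i (inv _ R) = role-forth b R
    role-back b i (univ u) = forth-full (B10 b u)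

module QuotientSemantics {S : Sig} (Φ : Phi) (𝓘 : Interp S) where
  open Interp 𝓘
  open IsBisim
  open Bisimulations {Φ = Φ} 𝓘

  _∼_ : Rel Δ _
  _∼_ = Bisimilar Φ 𝓘

  𝓠 : SInterp S _
  𝓠 = Quotient Φ 𝓘

  ⟦_⟧ʳ/∼ : Role S Φ → Rel Δ _
  ⟦_⟧ʳ/∼ = ⟦_⟧R 𝓠

  ⟦_⟧ᶜ/∼ : Concept S Φ → Δ → Set _
  ⟦_⟧ᶜ/∼ = ⟦_⟧C 𝓠

  ∼-isEquivalence : IsEquivalence _∼_
  ∼-isEquivalence = record
    { refl = _ , identity-bisim , refl
    ; sym = λ (Z , b , zx) → flip Z , converse-bisim b , zx
    ; trans = λ (Z , b , zx) (Z' , b' , z'y) → (Z ; Z') , compose-bisim b b' , (_ , zx , z'y)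
    }

  open IsEquivalence ∼-isEquivalence
    renaming (refl to ∼-refl; sym to ∼-sym; trans to ∼-trans)

  ∼-concept : (C : Concept S Φ) → ∀ {x x'} → x ∼ x' → ⟦ C ⟧ᶜ x → ⟦ C ⟧ᶜ x'
  ∼-concept C (Z , b , zx) = concept-preserved b C zx

  ∼-forth : (R : Role S Φ) → Forth _∼_ ⟦ R ⟧ʳ ⟦ R ⟧ʳ
  ∼-forth R (Z , b , zx) h =
    let (y' , zy , h') = role-forth b R zx h in y' , (Z , b , zy) , h'

  ∼-back : I∈ Φ → (R : Role S Φ) → Back _∼_ ⟦ R ⟧ʳ ⟦ R ⟧ʳ
  ∼-back i R (Z , b , zx) h =
    let (y' , zy , h') = role-back b i R zx h in y' , (Z , b , zy) , h'

  ∼-nominal : O∈ Φ → ∀ a {x} → x ∼ ind a → x ≡ ind a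
  ∼-nominal o a (Z , b , zx) = Equivalence.from (B7 b o a zx) refl

  open UpTo ∼-isEquivalence

  mutual
    concept-to-quotient : (C : Concept S Φ) → ∀ {x} → ⟦ C ⟧ᶜ x → ⟦ C ⟧ᶜ/∼ x
    concept-to-quotient (cname A) {x} h = x , ∼-refl , h
    concept-to-quotient top h = tt
    concept-to-quotient (neg C) h c = ⊥-elim (h (concept-from-quotient C c))
    concept-to-quotient (C ⊓c D) (c , d) =
      concept-to-quotient C c , concept-to-quotient D d
    concept-to-quotient (C ⊔c D) (inj₁ c) = inj₁ (concept-to-quotient C c)
    concept-to-quotient (C ⊔c D) (inj₂ d) = inj₂ (concept-to-quotient D d)
    concept-to-quotient (all R C) h y r =
      let (y' , r' , y'∼y) = role-from-quotient R r
      in concept-to-quotient C (∼-concept C y'∼y (h y' r'))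
    concept-to-quotient (ex R C) (y , r , c) =
      y , role-to-quotient R r , concept-to-quotient C c
    concept-to-quotient (nom o a) refl = ∼-refl

    concept-from-quotient : (C : Concept S Φ) → ∀ {x} → ⟦ C ⟧ᶜ/∼ x → ⟦ C ⟧ᶜ x
    concept-from-quotient (cname A) (_ , x₀∼x , h) = ∼-concept (cname A) x₀∼x h
    concept-from-quotient top h = tt
    concept-from-quotient (neg C) h c = ⊥-elim (h (concept-to-quotient C c))
    concept-from-quotient (C ⊓c D) (c , d) =
      concept-from-quotient C c , concept-from-quotient D d
    concept-from-quotient (C ⊔c D) (inj₁ c) = inj₁ (concept-from-quotient C c)
    concept-from-quotient (C ⊔c D) (inj₂ d) = inj₂ (concept-from-quotient D d)
    concept-from-quotient (all R C) h y r =
      concept-from-quotient C (h y (role-to-quotient R r))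
    concept-from-quotient (ex R C) (y , r , c) =
      let (y' , r' , y'∼y) = role-from-quotient R r
      in y' , r' , ∼-concept C (∼-sym y'∼y) (concept-from-quotient C c)
    concept-from-quotient (nom o a) x∼a = ∼-nominal o a x∼a

    role-to-quotient : (R : Role S Φ) → ⟦ R ⟧ʳ ⇒ ⟦ R ⟧ʳ/∼
    role-to-quotient (rname r) {x} {y} h = x , y , ∼-refl , ∼-refl , h
    role-to-quotient eps refl = ∼-refl
    role-to-quotient (R ∘ᵣ R') (w , h , h') =
      w , role-to-quotient R h , role-to-quotient R' h'
    role-to-quotient (R ⊔ᵣ R') (inj₁ h) = inj₁ (role-to-quotient R h)
    role-to-quotient (R ⊔ᵣ R') (inj₂ h) = inj₂ (role-to-quotient R' h)
    role-to-quotient (R *) = star-mono (λ { refl → ∼-refl }) (role-to-quotient R)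
    role-to-quotient (C ??) (refl , c) = ∼-refl , concept-to-quotient C c
    role-to-quotient (inv i R) = role-to-quotient R
    role-to-quotient (univ u) _ = tt

    role-from-quotient : (R : Role S Φ) → ⟦ R ⟧ʳ/∼ ⇒ (⟦ R ⟧ʳ ; _∼_)
    role-from-quotient (rname r) (_ , _ , x₀∼x , y₀∼y , h) =
      let (y' , y₀∼y' , h') = ∼-forth (rname r) x₀∼x h
      in y' , h' , ∼-trans (∼-sym y₀∼y') y₀∼y
    role-from-quotient eps {x} x∼y = x , refl , x∼y
    role-from-quotient (R ∘ᵣ R') =
      ∘-up-to {T₁ = ⟦ R ⟧ʳ/∼} (role-from-quotient R) (role-from-quotient R') (∼-forth R')
    role-from-quotient (R ⊔ᵣ R') (inj₁ h) = map₂ (map₁ inj₁) (role-from-quotient R h)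
    role-from-quotient (R ⊔ᵣ R') (inj₂ h) = map₂ (map₁ inj₂) (role-from-quotient R' h)
    role-from-quotient (R *) = star-up-to (role-from-quotient R) (∼-forth R)
    role-from-quotient (C ??) {x} (x∼y , c) = x , (refl , concept-from-quotient C c) , x∼y
    role-from-quotient (inv i R) h =
      let (x' , h' , x'∼x) = role-from-quotient R h
          (y' , y∼y' , h'') = ∼-back i R x'∼x h'
      in y' , h'' , ∼-sym y∼y'
    role-from-quotient (univ u) {y = y} _ = y , tt , ∼-refl

basicRole : ∀ {S Φ} → BasicRole S Φ → Role S Φ
basicRole (bname r) = rname r
basicRole (binv i r) = inv i (rname r)

chainRole : ∀ {S Φ} → BasicRole S Φ → List (BasicRole S Φ) → Role S Φ
chainRole R [] = basicRole R
chainRole R (R' ∷ Rs) = basicRole R ∘ᵣ chainRole R' Rs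

basic-as-role : ∀ {S Φ ℓ} (𝓙 : SInterp S ℓ) (R : BasicRole S Φ) {x y} →
                ⟦_⟧B 𝓙 R x y ⇔ ⟦_⟧R 𝓙 (basicRole R) x y
basic-as-role 𝓙 (bname r) = mk⇔ (λ h → h) (λ h → h)
basic-as-role 𝓙 (binv i r) = mk⇔ (λ h → h) (λ h → h)

chain-as-role : ∀ {S Φ ℓ} (𝓙 : SInterp S ℓ) (R : BasicRole S Φ) Rs {x y} →
                chain 𝓙 R Rs x y ⇔ ⟦_⟧R 𝓙 (chainRole R Rs) x y
chain-as-role 𝓙 R [] = basic-as-role 𝓙 R
chain-as-role 𝓙 R (R' ∷ Rs) = mk⇔
  (λ (w , h , c) → w , Equivalence.to (basic-as-role 𝓙 R) h ,
                       Equivalence.to (chain-as-role 𝓙 R' Rs) c)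
  (λ (w , h , c) → w , Equivalence.from (basic-as-role 𝓙 R) h ,
                       Equivalence.from (chain-as-role 𝓙 R' Rs) c)

module _ {S : Sig} (Φ : Phi) (𝓘 : Interp S) where
  open QuotientSemantics Φ 𝓘
  open IsEquivalence ∼-isEquivalence renaming (refl to ∼-refl; reflexive to ∼-reflexive)

  form₁-invariant : ∀ (φ : Form₁ S Φ) → (_⊨₁_ (toS 𝓘) φ ⇔ _⊨₁_ 𝓠 φ)
  form₁-invariant (C ⊑ D) =
    mk⇔ (λ C⊑D x c → concept-to-quotient D (C⊑D x (concept-from-quotient C c)))
        (λ C⊑D x c → concept-from-quotient D (C⊑D x (concept-to-quotient C c)))
  form₁-invariant (C ⟨ a ⟩) = mk⇔ (concept-to-quotient C) (concept-from-quotient C)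

  -- (2) role inclusions and role/equality assertions are preserved: a
  -- quotient chain step is a chain step of 𝓘 up to ∼, hence an r-step of 𝓘
  -- up to ∼, which the quotient interpretation of r absorbs
  form₂-preserved : ∀ (ψ : Form₂ S Φ) → _⊨₂_ (toS 𝓘) ψ → _⊨₂_ 𝓠 ψ
  form₂-preserved (riaε r) ε⊑r x y x∼y = x , x , ∼-refl , x∼y , ε⊑r x x refl
  form₂-preserved (ria (R ∷ Rs) r) chain⊑r x y c =
    let (y' , h , y'∼y) = role-from-quotient (chainRole R Rs)
                            (Equivalence.to (chain-as-role 𝓠 R Rs) c)
    in x , y' , ∼-refl , y'∼y , chain⊑r x y' (Equivalence.from (chain-as-role (toS 𝓘) R Rs) h)
  form₂-preserved (rasrt R a b) = role-to-quotient R
  form₂-preserved (eqasrt a b) = ∼-reflexive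

theorem10 : ∀ {S : Sig} (Φ : Phi) (𝓘 : Interp S) →
    (∀ (φ : Form₁ S Φ) → (_⊨₁_ (toS 𝓘) φ ⇔ _⊨₁_ (Quotient Φ 𝓘) φ))
    × (∀ (ψ : Form₂ S Φ) → _⊨₂_ (toS 𝓘) ψ → _⊨₂_ (Quotient Φ 𝓘) ψ)
theorem10 Φ 𝓘 = form₁-invariant Φ 𝓘 , form₂-preserved Φ 𝓘
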